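{- Let $m \ge 3$ be an odd integer and let $\Gamma = C_{2m} \square C_{2m}$, viewed as the Cayley graph of $\mathbb{Z}_{2m} \times \mathbb{Z}_{2m}$ with connection set $\{\pm(1,0),\pm(0,1)\}$. Suppose $\ell$ is a distance magic labeling of $\Gamma$, and write $\ell_{i,j}=\ell((i,j))$ (indices modulo $2m$). Then $\ell_{i,j} = -\ell_{i+m,j+m}$ for all $i,j$ with $0 \le i,j < 2m$.
   Context: For a positive integer $N$ let $\mathcal{N}_N=\{1-N,3-N,5-N,\ldots,N-1\}$. For a graph $\Gamma=(V,E)$ of order $N$, a distance magic labeling is a bijection $\ell: V \to \mathcal{N}_N$ such that for every vertex $v$ the sum of $\ell(u)$ over all neighbours $u$ of $v$ equals $0$. -}

module Defs where

open import Data.Nat as ℕ using (ℕ; suc; NonZero)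
open import Data.Nat.DivMod using (_mod_)
open import Data.Fin as Fin using (Fin; toℕ)
open import Data.Fin.Properties as FinP using ()
open import Data.Integer as ℤ using (ℤ; +_; -_)
open import Data.Product using (_×_; _,_; Σ)
open import Data.Product.Properties using (≡-dec)
open import Data.List using (List; []; _∷_; filter; map; foldr; allFin; cartesianProduct)
open import Data.List.Membership.DecPropositional using ()
open import Data.List.Relation.Unary.Any using (any?)
open import Relation.Binary.PropositionalEquality using (_≡_)
open import Function.Bundles using (_⤖_; Bijection)

sumℤ : List ℤ → ℤ
sumℤ = foldr ℤ._+_ (+ 0)

-- The label set 𝒩_N = {1-N, 3-N, ..., N-1}, enumerated by Fin N:  k ↦ 2k+1-N.
labelVal : (N : ℕ) → Fin N → ℤ
labelVal N k = (+ (2 ℕ.* toℕ k ℕ.+ 1)) ℤ.- (+ N)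

module Zn (n : ℕ) .{{_ : NonZero n}} where
  _⊕_ : Fin n → Fin n → Fin n
  a ⊕ b = (toℕ a ℕ.+ toℕ b) mod n

  ⊖_ : Fin n → Fin n
  ⊖ a = (n ℕ.∸ toℕ a) mod n

  _⊖_ : Fin n → Fin n → Fin n
  a ⊖ b = a ⊕ (⊖ b)

  fromℕ : ℕ → Fin n
  fromℕ k = k mod n

module Torus (n : ℕ) .{{nz : NonZero n}} where
  open Zn n

  V : Set
  V = Fin n × Fin n

  _-ᵥ_ : V → V → V
  (a , b) -ᵥ (c , d) = (a ⊖ c) , (b ⊖ d)

  S : List V
  S = (fromℕ 1 , fromℕ 0) ∷ (⊖ fromℕ 1 , fromℕ 0)
    ∷ (fromℕ 0 , fromℕ 1) ∷ (fromℕ 0 , ⊖ fromℕ 1) ∷ []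

  allV : List V
  allV = cartesianProduct (allFin n) (allFin n)

  -- Cayley graph Cay(ℤ_n × ℤ_n, S): u ~ v iff u - v ∈ S.
  -- The neighbours of v, listed once each (allV enumerates V without repetition).
  neighbours : V → List V
  neighbours v = filter (λ u → any? (λ s → ≡-dec FinP._≟_ FinP._≟_ (u -ᵥ v) s) S) allV

  -- Distance magic labeling of Cay(ℤ_n × ℤ_n, S) (order N = n*n):
  -- ℓ is a bijection V → 𝒩_N (i.e. ℓ = labelVal N ∘ σ for a bijection σ : V ⤖ Fin N),
  -- and every neighbourhood sums to 0.
  IsDistanceMagic : (V → ℤ) → Set
  IsDistanceMagic ℓ =
    Σ (V ⤖ Fin (n ℕ.* n)) (λ σ →
      ((v : V) → ℓ v ≡ labelVal (n ℕ.* n) (Bijection.to σ v)))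
    × ((v : V) → sumℤ (map ℓ (neighbours v)) ≡ + 0)

{-# OPTIONS --safe #-}
-- Lift ℓ to the 2m-periodic function f x y = ℓ (x mod 2m , y mod 2m) on ℕ². The vanishing
-- neighbourhood sum at (x+1, y+1) says exactly that D x y = f x y + f (x+1) (y+1) satisfies
-- D (x+1) y = - D x (y+1); moving an odd number m of steps, D (x+m) y = - D x (y+m). This in
-- turn says that A x y = f (x+m) y + f x (y+m) satisfies A (x+1) (y+1) = - A x y, so again
-- A (x+m) (y+m) = - A x y. By 2m-periodicity A (x+m) (y+m) = A x y, hence A = 0, and
-- A x (y+m) = f (x+m) (y+m) + f x y = 0 is the claim. (D and A are diagonalPair and
-- antipodalPair below.)
module Submission where

open import Defs
open import Data.Empty using (⊥-elim)
open import Data.Fin using (Fin; toℕ)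
open import Data.Fin.Properties using (toℕ-fromℕ<; toℕ<n; fromℕ<-cong; fromℕ<-toℕ; _≟_)
open import Data.Integer as ℤ using (ℤ; +_; -_; -[1+_]; 0ℤ)
import Data.Integer.Properties as ℤₚ
import Data.Integer.Tactic.RingSolver as ℤ-Solver
open import Data.List using ([]; _∷_; map)
open import Data.List.Membership.Propositional using (_∈_)
open import Data.List.Membership.Propositional.Properties
  using (∈-map⁺; ∈-map⁻; ∈-filter⁺; ∈-filter⁻; ∈-cartesianProduct⁺; ∈-allFin)
open import Data.List.Membership.Propositional.Properties.WithK using (unique∧set⇒bag)
open import Data.List.Relation.Binary.BagAndSetEquality using (∼bag⇒↭)
open import Data.List.Relation.Binary.Permutation.Propositional using (_↭_; ↭⇒↭ₛ)
import Data.List.Relation.Binary.Permutation.Propositional.Properties as ↭ₚ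
open import Data.List.Relation.Binary.Permutation.Setoid.Properties using (foldr-commMonoid)
open import Data.List.Relation.Unary.All using ([]; _∷_)
open import Data.List.Relation.Unary.AllPairs using ([]; _∷_)
open import Data.List.Relation.Unary.Any using (any?)
open import Data.List.Relation.Unary.Unique.Propositional using (Unique)
import Data.List.Relation.Unary.Unique.Propositional.Properties as Uniqueₚ
open import Data.Nat using (ℕ; zero; suc; _+_; _*_; _∸_; _≤_; _<_; _%_; NonZero; s≤s; z≤n)
open import Data.Nat.DivMod using (_mod_; m%n<n; %-distribˡ-+; [m+n]%n≡m%n; m<n⇒m%n≡m)
open import Data.Nat.Divisibility using (_∣_; _∣0; ∣m∣n⇒∣m+n; ∣-refl)
import Data.Nat.Properties as ℕₚ
import Data.Nat.Tactic.RingSolver as ℕ-Solver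
open import Data.Product using (_×_; _,_; proj₁; proj₂)
open import Data.Product.Properties using (≡-dec)
open import Function using (_∘_)
open import Function.Bundles using (mk⇔; _⇔_)
open import Relation.Binary.PropositionalEquality
open import Relation.Nullary using (¬_)
open import Relation.Unary using (Decidable)

open import Algebra.Properties.CommutativeSemigroup ℕₚ.+-commutativeSemigroup using (x∙yz≈y∙xz)
open import Algebra.Properties.AbelianGroup ℤₚ.+-0-abelianGroup using (inverseˡ-unique)

open ≡-Reasoning

sumℤ-↭ : ∀ {xs ys} → xs ↭ ys → sumℤ xs ≡ sumℤ ys
sumℤ-↭ p = foldr-commMonoid (setoid ℤ) ℤₚ.+-0-isCommutativeMonoid (↭⇒↭ₛ p)

i+j≡0⇒i≡-j : ∀ {i j} → i ℤ.+ j ≡ 0ℤ → i ≡ - j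
i+j≡0⇒i≡-j {i} {j} = inverseˡ-unique i j

i≡-j⇒i+j≡0 : ∀ {i j} → i ≡ - j → i ℤ.+ j ≡ 0ℤ
i≡-j⇒i+j≡0 {j = j} refl = ℤₚ.+-inverseˡ j

i≡-i⇒i≡0 : ∀ {i} → i ≡ - i → i ≡ 0ℤ
i≡-i⇒i≡0 {+ zero}    _ = refl
i≡-i⇒i≡0 {+ suc _}   ()
i≡-i⇒i≡0 { -[1+ _ ]} ()

shift-transfer-odd : (h : ℕ → ℕ → ℤ) → (∀ x y → h (suc x) y ≡ - h x (suc y)) →
                     ∀ {m} → ¬ 2 ∣ m → ∀ x y → h (m + x) y ≡ - h x (m + y)
shift-transfer-odd h step {zero}        m-odd   x y = ⊥-elim (m-odd (2 ∣0))
shift-transfer-odd h step {suc zero}    _       x y = step x y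
shift-transfer-odd h step {suc (suc m)} 2+m-odd x y = begin
  h (2 + m + x) y          ≡⟨ step (1 + m + x) y ⟩
  - h (1 + m + x) (1 + y)  ≡⟨ cong -_ (step (m + x) (1 + y)) ⟩
  - - h (m + x) (2 + y)    ≡⟨ ℤₚ.neg-involutive _ ⟩
  h (m + x) (2 + y)        ≡⟨ shift-transfer-odd h step m-odd x (2 + y) ⟩
  - h x (m + (2 + y))      ≡⟨ cong (-_ ∘ h x) (trans (ℕₚ.+-suc m (1 + y)) (cong suc (ℕₚ.+-suc m y))) ⟩
  - h x (2 + m + y)        ∎
  where
    m-odd : ¬ 2 ∣ m
    m-odd 2∣m = 2+m-odd (∣m∣n⇒∣m+n ∣-refl 2∣m)

antiperiodic-odd : (h : ℕ → ℤ) → (∀ x → h (suc x) ≡ - h x) → ∀ {m} → ¬ 2 ∣ m → h m ≡ - h 0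
antiperiodic-odd h step {m} m-odd = subst (λ k → h k ≡ - h 0) (ℕₚ.+-identityʳ m)
  (shift-transfer-odd (λ x _ → h x) (λ x _ → step x) m-odd 0 0)

m+[m+x]≡x+2*m : ∀ m x → m + (m + x) ≡ x + 2 * m
m+[m+x]≡x+2*m = ℕ-Solver.solve-∀

NeighbourSumsVanish : (ℕ → ℕ → ℤ) → Set
NeighbourSumsVanish f = ∀ x y →
  sumℤ (f (2 + x) (1 + y) ∷ f x (1 + y) ∷ f (1 + x) (2 + y) ∷ f (1 + x) y ∷ []) ≡ 0ℤ

Periodic : ℕ → (ℕ → ℕ → ℤ) → Set
Periodic p f = ∀ x y → f (x + p) y ≡ f x y × f x (y + p) ≡ f x y

module _ {m : ℕ} (m-odd : ¬ 2 ∣ m) (f : ℕ → ℕ → ℤ)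
         (vanish : NeighbourSumsVanish f) (periodic : Periodic (2 * m) f) where

  private
    f-half-shift-twiceˡ : ∀ x y → f (m + (m + x)) y ≡ f x y
    f-half-shift-twiceˡ x y = trans (cong (λ k → f k y) (m+[m+x]≡x+2*m m x)) (proj₁ (periodic x y))

    f-half-shift-twiceʳ : ∀ x y → f x (m + (m + y)) ≡ f x y
    f-half-shift-twiceʳ x y = trans (cong (f x) (m+[m+x]≡x+2*m m y)) (proj₂ (periodic x y))

    diagonalPair : ℕ → ℕ → ℤ
    diagonalPair x y = f x y ℤ.+ f (1 + x) (1 + y)

    diagonalPair-step : ∀ x y → diagonalPair (suc x) y ≡ - diagonalPair x (suc y)
    diagonalPair-step x y = i+j≡0⇒i≡-j
      (trans (regroup (f (2 + x) (1 + y)) (f x (1 + y)) (f (1 + x) (2 + y)) (f (1 + x) y)) (vanish x y))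
      where
        regroup : ∀ a b c d → d ℤ.+ a ℤ.+ (b ℤ.+ c) ≡ a ℤ.+ (b ℤ.+ (c ℤ.+ (d ℤ.+ 0ℤ)))
        regroup = ℤ-Solver.solve-∀

    antipodalPair : ℕ → ℕ → ℤ
    antipodalPair x y = f (m + x) y ℤ.+ f x (m + y)

    antipodalPair-step : ∀ x y → antipodalPair (suc x) (suc y) ≡ - antipodalPair x y
    antipodalPair-step x y = i+j≡0⇒i≡-j (begin
      antipodalPair (suc x) (suc y) ℤ.+ antipodalPair x y
        ≡⟨ cong₂ (λ u v → f u (suc y) ℤ.+ f (suc x) v ℤ.+ antipodalPair x y)
                 (ℕₚ.+-suc m x) (ℕₚ.+-suc m y) ⟩
      f (suc (m + x)) (suc y) ℤ.+ f (suc x) (suc (m + y)) ℤ.+ (f (m + x) y ℤ.+ f x (m + y))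
        ≡⟨ regroup (f (m + x) y) (f (suc (m + x)) (suc y)) (f x (m + y)) (f (suc x) (suc (m + y))) ⟩
      diagonalPair (m + x) y ℤ.+ diagonalPair x (m + y)
        ≡⟨ i≡-j⇒i+j≡0 (shift-transfer-odd diagonalPair diagonalPair-step m-odd x y) ⟩
      0ℤ ∎)
      where
        regroup : ∀ a b c d → b ℤ.+ d ℤ.+ (a ℤ.+ c) ≡ a ℤ.+ b ℤ.+ (c ℤ.+ d)
        regroup = ℤ-Solver.solve-∀

    antipodalPair-half-shift : ∀ x y → antipodalPair (m + x) (m + y) ≡ antipodalPair x y
    antipodalPair-half-shift x y = begin
      f (m + (m + x)) (m + y) ℤ.+ f (m + x) (m + (m + y))
        ≡⟨ cong₂ ℤ._+_ (f-half-shift-twiceˡ x (m + y)) (f-half-shift-twiceʳ (m + x) y) ⟩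
      f x (m + y) ℤ.+ f (m + x) y
        ≡⟨ ℤₚ.+-comm (f x (m + y)) (f (m + x) y) ⟩
      antipodalPair x y ∎

    antipodalPair≡0 : ∀ x y → antipodalPair x y ≡ 0ℤ
    antipodalPair≡0 x y = i≡-i⇒i≡0 (begin
      antipodalPair x y              ≡⟨ antipodalPair-half-shift x y ⟨
      antipodalPair (m + x) (m + y)  ≡⟨ antiperiodic-odd (λ t → antipodalPair (t + x) (t + y))
                                          (λ t → antipodalPair-step (t + x) (t + y)) m-odd ⟩
      - antipodalPair x y            ∎)

  half-period-shift-negates : ∀ x y → f x y ≡ - f (m + x) (m + y)
  half-period-shift-negates x y = i+j≡0⇒i≡-j (begin
    f x y ℤ.+ f (m + x) (m + y)            ≡⟨ ℤₚ.+-comm (f x y) (f (m + x) (m + y)) ⟩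
    f (m + x) (m + y) ℤ.+ f x y
      ≡⟨ cong (λ k → f (m + x) (m + y) ℤ.+ k) (f-half-shift-twiceʳ x y) ⟨
    antipodalPair x (m + y)                ≡⟨ antipodalPair≡0 x (m + y) ⟩
    0ℤ                                     ∎)

module ZnProperties (n : ℕ) .{{_ : NonZero n}} where
  open Zn n

  toℕ-mod : ∀ k → toℕ (k mod n) ≡ k % n
  toℕ-mod k = toℕ-fromℕ< (m%n<n k n)

  toℕ-mod-< : ∀ {k} → k < n → toℕ (k mod n) ≡ k
  toℕ-mod-< {k} k<n = trans (toℕ-mod k) (m<n⇒m%n≡m k<n)

  mod-cong : ∀ {k l} → k % n ≡ l % n → k mod n ≡ l mod n
  mod-cong {k} {l} eq = fromℕ<-cong (k % n) (l % n) eq (m%n<n k n) (m%n<n l n)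

  toℕ-mod-inverse : ∀ a → toℕ a mod n ≡ a
  toℕ-mod-inverse a = trans (fromℕ<-cong _ _ (m<n⇒m%n≡m (toℕ<n a)) (m%n<n (toℕ a) n) (toℕ<n a))
                            (fromℕ<-toℕ a (toℕ<n a))

  mod-periodic : ∀ k → (k + n) mod n ≡ k mod n
  mod-periodic k = mod-cong ([m+n]%n≡m%n k n)

  ⊕-mod : ∀ k l → (k mod n) ⊕ (l mod n) ≡ (k + l) mod n
  ⊕-mod k l = mod-cong (begin
    (toℕ (k mod n) + toℕ (l mod n)) % n  ≡⟨ cong₂ (λ a b → (a + b) % n) (toℕ-mod k) (toℕ-mod l) ⟩
    (k % n + l % n) % n                  ≡⟨ %-distribˡ-+ k l n ⟨
    (k + l) % n                          ∎)

  ⊕-modʳ : ∀ a l → a ⊕ (l mod n) ≡ (toℕ a + l) mod n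
  ⊕-modʳ a l = trans (cong (_⊕ (l mod n)) (sym (toℕ-mod-inverse a))) (⊕-mod (toℕ a) l)

  private
    [a+[b+[n∸a]]]mod-n≡b : ∀ a b → (toℕ a + (toℕ b + (n ∸ toℕ a))) mod n ≡ b
    [a+[b+[n∸a]]]mod-n≡b a b = begin
      (toℕ a + (toℕ b + (n ∸ toℕ a))) mod n  ≡⟨ cong (_mod n) (x∙yz≈y∙xz (toℕ a) (toℕ b) _) ⟩
      (toℕ b + (toℕ a + (n ∸ toℕ a))) mod n  ≡⟨ cong (λ k → (toℕ b + k) mod n) (ℕₚ.m+[n∸m]≡n (ℕₚ.<⇒≤ (toℕ<n a))) ⟩
      (toℕ b + n) mod n                      ≡⟨ mod-periodic (toℕ b) ⟩
      toℕ b mod n                            ≡⟨ toℕ-mod-inverse b ⟩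
      b                                      ∎

  [a⊕b]⊖a≡b : ∀ a b → (a ⊕ b) ⊖ a ≡ b
  [a⊕b]⊖a≡b a b = begin
    (a ⊕ b) ⊖ a                             ≡⟨ ⊕-mod (toℕ a + toℕ b) (n ∸ toℕ a) ⟩
    (toℕ a + toℕ b + (n ∸ toℕ a)) mod n     ≡⟨ cong (_mod n) (ℕₚ.+-assoc (toℕ a) (toℕ b) _) ⟩
    (toℕ a + (toℕ b + (n ∸ toℕ a))) mod n   ≡⟨ [a+[b+[n∸a]]]mod-n≡b a b ⟩
    b                                       ∎

  a⊕[b⊖a]≡b : ∀ a b → a ⊕ (b ⊖ a) ≡ b
  a⊕[b⊖a]≡b a b = begin
    a ⊕ (b ⊖ a)                             ≡⟨ cong (a ⊕_) (⊕-modʳ b (n ∸ toℕ a)) ⟩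
    a ⊕ ((toℕ b + (n ∸ toℕ a)) mod n)       ≡⟨ ⊕-modʳ a _ ⟩
    (toℕ a + (toℕ b + (n ∸ toℕ a))) mod n   ≡⟨ [a+[b+[n∸a]]]mod-n≡b a b ⟩
    b                                       ∎

module TorusProperties (n : ℕ) .{{_ : NonZero n}} where
  open Zn n
  open Torus n
  open ZnProperties n

  infixl 6 _+ᵥ_
  _+ᵥ_ : V → V → V
  (a , b) +ᵥ (c , d) = a ⊕ c , b ⊕ d

  [u+ᵥv]-ᵥu≡v : ∀ u v → (u +ᵥ v) -ᵥ u ≡ v
  [u+ᵥv]-ᵥu≡v (a , b) (c , d) = cong₂ _,_ ([a⊕b]⊖a≡b a c) ([a⊕b]⊖a≡b b d)

  u+ᵥ[v-ᵥu]≡v : ∀ u v → u +ᵥ (v -ᵥ u) ≡ v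
  u+ᵥ[v-ᵥu]≡v (a , b) (c , d) = cong₂ _,_ (a⊕[b⊖a]≡b a c) (a⊕[b⊖a]≡b b d)

  +ᵥ-cancelˡ : ∀ u {v w} → u +ᵥ v ≡ u +ᵥ w → v ≡ w
  +ᵥ-cancelˡ u {v} {w} eq = begin
    v                 ≡⟨ [u+ᵥv]-ᵥu≡v u v ⟨
    (u +ᵥ v) -ᵥ u     ≡⟨ cong (_-ᵥ u) eq ⟩
    (u +ᵥ w) -ᵥ u     ≡⟨ [u+ᵥv]-ᵥu≡v u w ⟩
    w                 ∎

  lift : (V → ℤ) → ℕ → ℕ → ℤ
  lift ℓ x y = ℓ (x mod n , y mod n)

  lift-periodic : ∀ ℓ → Periodic n (lift ℓ)
  lift-periodic ℓ x y = cong (λ a → ℓ (a , y mod n)) (mod-periodic x)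
                      , cong (λ b → ℓ (x mod n , b)) (mod-periodic y)

  lift-toℕ : ∀ ℓ a b → ℓ (a , b) ≡ lift ℓ (toℕ a) (toℕ b)
  lift-toℕ ℓ a b = sym (cong₂ (λ c d → ℓ (c , d)) (toℕ-mod-inverse a) (toℕ-mod-inverse b))

  lift-translate : ∀ ℓ k a b → ℓ (a ⊕ fromℕ k , b ⊕ fromℕ k) ≡ lift ℓ (k + toℕ a) (k + toℕ b)
  lift-translate ℓ k a b = cong₂ (λ c d → ℓ (c , d)) (translate a) (translate b)
    where
      translate : ∀ c → c ⊕ fromℕ k ≡ (k + toℕ c) mod n
      translate c = trans (⊕-modʳ c k) (cong (_mod n) (ℕₚ.+-comm (toℕ c) k))

  module _ (3≤n : 3 ≤ n) where
    1<n : 1 < n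
    1<n = ℕₚ.<-trans (s≤s (s≤s z≤n)) 3≤n

    ⊖1≡[n∸1]mod-n : ⊖ fromℕ 1 ≡ (n ∸ 1) mod n
    ⊖1≡[n∸1]mod-n = cong (λ k → (n ∸ k) mod n) (toℕ-mod-< 1<n)

    S-unique : Unique S
    S-unique = (fst 1≢-1 ∷ fst 1≢0 ∷ fst 1≢0 ∷ [])
             ∷ (fst -1≢0 ∷ fst -1≢0 ∷ [])
             ∷ (snd 1≢-1 ∷ [])
             ∷ []
             ∷ []
      where
        distinct : ∀ {a b : Fin n} {k l} → toℕ a ≡ k → toℕ b ≡ l → k ≢ l → a ≢ b
        distinct refl refl k≢l = k≢l ∘ cong toℕ

        fst : ∀ {a b c d : Fin n} → a ≢ c → (a , b) ≢ (c , d)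
        fst a≢c = a≢c ∘ cong proj₁

        snd : ∀ {a b c d : Fin n} → b ≢ d → (a , b) ≢ (c , d)
        snd b≢d = b≢d ∘ cong proj₂

        1<n∸1 : 1 < n ∸ 1
        1<n∸1 = ℕₚ.∸-monoˡ-≤ 1 3≤n

        toℕ-0 : toℕ (fromℕ 0) ≡ 0
        toℕ-0 = toℕ-mod-< (ℕₚ.<-trans (s≤s z≤n) 1<n)

        toℕ-1 : toℕ (fromℕ 1) ≡ 1
        toℕ-1 = toℕ-mod-< 1<n

        toℕ-[-1] : toℕ (⊖ fromℕ 1) ≡ n ∸ 1
        toℕ-[-1] = trans (cong toℕ ⊖1≡[n∸1]mod-n) (toℕ-mod-< (ℕₚ.∸-monoʳ-< (s≤s z≤n) (ℕₚ.<⇒≤ 1<n)))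

        1≢0 : fromℕ 1 ≢ fromℕ 0
        1≢0 = distinct toℕ-1 toℕ-0 λ ()

        1≢-1 : fromℕ 1 ≢ ⊖ fromℕ 1
        1≢-1 = distinct toℕ-1 toℕ-[-1] (ℕₚ.<⇒≢ 1<n∸1)

        -1≢0 : ⊖ fromℕ 1 ≢ fromℕ 0
        -1≢0 = distinct toℕ-[-1] toℕ-0 (ℕₚ.>⇒≢ (ℕₚ.<-trans (s≤s z≤n) 1<n∸1))

    -- the decision procedure that `neighbours` filters with
    adjacent? : ∀ v → Decidable (λ u → u -ᵥ v ∈ S)
    adjacent? v u = any? (λ s → ≡-dec _≟_ _≟_ (u -ᵥ v) s) S

    ∈-neighbours⇔ : ∀ {v u} → u ∈ neighbours v ⇔ u ∈ map (v +ᵥ_) S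
    ∈-neighbours⇔ {v} {u} = mk⇔ to from
      where
        to : u ∈ neighbours v → u ∈ map (v +ᵥ_) S
        to u∈ = subst (_∈ map (v +ᵥ_) S) (u+ᵥ[v-ᵥu]≡v v u)
                  (∈-map⁺ (v +ᵥ_) (proj₂ (∈-filter⁻ (adjacent? v) {xs = allV} u∈)))

        from : u ∈ map (v +ᵥ_) S → u ∈ neighbours v
        from u∈ with ∈-map⁻ (v +ᵥ_) u∈
        ... | s , s∈S , refl = ∈-filter⁺ (adjacent? v) (∈-cartesianProduct⁺ (∈-allFin _) (∈-allFin _))
                                 (subst (_∈ S) (sym ([u+ᵥv]-ᵥu≡v v s)) s∈S)

    neighbours-↭ : ∀ v → neighbours v ↭ map (v +ᵥ_) S
    neighbours-↭ v = ∼bag⇒↭ (unique∧set⇒bag neighbours-unique translates-unique ∈-neighbours⇔)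
      where
        neighbours-unique : Unique (neighbours v)
        neighbours-unique = Uniqueₚ.filter⁺ (adjacent? v)
                              (Uniqueₚ.cartesianProduct⁺ (Uniqueₚ.allFin⁺ n) (Uniqueₚ.allFin⁺ n))

        translates-unique : Unique (map (v +ᵥ_) S)
        translates-unique = Uniqueₚ.map⁺ (+ᵥ-cancelˡ v) S-unique

    translates-mod : ∀ x y → map ((suc x mod n , suc y mod n) +ᵥ_) S
      ≡ ((2 + x) mod n , (1 + y) mod n) ∷ (x mod n , (1 + y) mod n)
      ∷ ((1 + x) mod n , (2 + y) mod n) ∷ ((1 + x) mod n , y mod n) ∷ []
    translates-mod x y =
      cong₂ _∷_ (cong₂ _,_ (step-up x)   (step-zero y)) (
      cong₂ _∷_ (cong₂ _,_ (step-down x) (step-zero y)) (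
      cong₂ _∷_ (cong₂ _,_ (step-zero x) (step-up y))   (
      cong₂ _∷_ (cong₂ _,_ (step-zero x) (step-down y)) refl)))
      where
        step-up : ∀ k → (suc k mod n) ⊕ fromℕ 1 ≡ (2 + k) mod n
        step-up k = trans (⊕-mod (suc k) 1) (cong (_mod n) (ℕₚ.+-comm (suc k) 1))

        step-zero : ∀ k → (suc k mod n) ⊕ fromℕ 0 ≡ suc k mod n
        step-zero k = trans (⊕-mod (suc k) 0) (cong (_mod n) (ℕₚ.+-identityʳ (suc k)))

        step-down : ∀ k → (suc k mod n) ⊕ (⊖ fromℕ 1) ≡ k mod n
        step-down k = begin
          (suc k mod n) ⊕ (⊖ fromℕ 1)       ≡⟨ cong ((suc k mod n) ⊕_) ⊖1≡[n∸1]mod-n ⟩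
          (suc k mod n) ⊕ ((n ∸ 1) mod n)   ≡⟨ ⊕-mod (suc k) (n ∸ 1) ⟩
          (suc k + (n ∸ 1)) mod n           ≡⟨ cong (_mod n) (ℕₚ.+-suc k (n ∸ 1)) ⟨
          (k + (1 + (n ∸ 1))) mod n         ≡⟨ cong (λ l → (k + l) mod n) (ℕₚ.m+[n∸m]≡n (ℕₚ.<⇒≤ 1<n)) ⟩
          (k + n) mod n                     ≡⟨ mod-periodic k ⟩
          k mod n                           ∎

    lift-neighbourSumsVanish : ∀ ℓ → (∀ v → sumℤ (map ℓ (neighbours v)) ≡ 0ℤ) →
                               NeighbourSumsVanish (lift ℓ)
    lift-neighbourSumsVanish ℓ zero-sums x y =
      trans (cong (sumℤ ∘ map ℓ) (sym (translates-mod x y))) (begin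
      sumℤ (map ℓ (map (v +ᵥ_) S))     ≡⟨ sumℤ-↭ (↭ₚ.map⁺ ℓ (neighbours-↭ v)) ⟨
      sumℤ (map ℓ (neighbours v))      ≡⟨ zero-sums v ⟩
      0ℤ                               ∎)
      where v = (suc x mod n , suc y mod n)

corollary2p4 : (m : ℕ) → 3 ≤ m → ¬ (2 ∣ m) → .{{_ : NonZero (2 * m)}} →
    (ℓ : Torus.V (2 * m) → ℤ) → Torus.IsDistanceMagic (2 * m) ℓ →
    (i j : Fin (2 * m)) →
    ℓ (i , j) ≡ - ℓ (Zn._⊕_ (2 * m) i (Zn.fromℕ (2 * m) m) , Zn._⊕_ (2 * m) j (Zn.fromℕ (2 * m) m))
corollary2p4 m 3≤m m-odd ℓ (_ , zero-sums) i j = begin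
  ℓ (i , j)                          ≡⟨ lift-toℕ ℓ i j ⟩
  lift ℓ (toℕ i) (toℕ j)             ≡⟨ half-period-shift-negates m-odd (lift ℓ) vanish (lift-periodic ℓ)
                                                                    (toℕ i) (toℕ j) ⟩
  - lift ℓ (m + toℕ i) (m + toℕ j)   ≡⟨ cong -_ (lift-translate ℓ m i j) ⟨
  - ℓ (i ⊕ fromℕ m , j ⊕ fromℕ m)    ∎
  where
    open Zn (2 * m)
    open TorusProperties (2 * m)

    vanish : NeighbourSumsVanish (lift ℓ)
    vanish = lift-neighbourSumsVanish (ℕₚ.≤-trans 3≤m (ℕₚ.m≤n*m m 2)) ℓ zero-sums
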